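{- Let $G$ be a graph containing a vertex $x$, and let $G^x$ be the graph obtained from $G$ by adding a new vertex $x'$ whose neighbourhood equals the neighbourhood of $x$ (so $x'$ is non-adjacent to $x$). Then $G^x$ is $(\overline{2P_1+P_3},P_5)$-free if and only if $G$ is $(\overline{2P_1+P_3},P_5)$-free.
   Context: All graphs are finite and simple. $P_n$ is the path on $n$ vertices, $G+H$ disjoint union, $\overline{G}$ the complement. A graph is $(H_1,H_2)$-free if it contains no induced subgraph isomorphic to $H_1$ or to $H_2$. -}

module Defs where

open import Data.Nat using (ℕ; zero; suc)
open import Data.Fin using (Fin; zero; suc; toℕ)
open import Data.Fin.Properties using (_≟_)
open import Data.Bool using (Bool; true; false; not)
open import Data.Product using (Σ; _×_)
open import Relation.Binary.PropositionalEquality using (_≡_; refl; sym)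
open import Relation.Nullary using (¬_; yes; no)
open import Function.Definitions using (Injective)

record Graph (n : ℕ) : Set where
  field
    adj    : Fin n → Fin n → Bool
    adj-sym    : ∀ i j → adj i j ≡ adj j i
    adj-irrefl : ∀ i → adj i i ≡ false
open Graph public

InducedSub : ∀ {k n} → Graph k → Graph n → Set
InducedSub {k} {n} H G =
  Σ (Fin k → Fin n) λ f →
    Injective _≡_ _≡_ f × (∀ i j → adj G (f i) (f j) ≡ adj H i j)

Contains : ∀ {k n} → Graph n → Graph k → Set
Contains G H = InducedSub H G

Free₂ : ∀ {k l n} → Graph k → Graph l → Graph n → Set
Free₂ H₁ H₂ G = ¬ Contains G H₁ × ¬ Contains G H₂

-- i ~ j iff j = i + 1 or i = j + 1
isOne : ℕ → Bool
isOne (suc zero) = true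
isOne _ = false

adjℕ : ℕ → ℕ → Bool
adjℕ zero b = isOne b
adjℕ (suc a) zero = isOne (suc a)
adjℕ (suc a) (suc b) = adjℕ a b

adjℕ-sym : ∀ a b → adjℕ a b ≡ adjℕ b a
adjℕ-sym zero zero = refl
adjℕ-sym zero (suc b) = refl
adjℕ-sym (suc a) zero = refl
adjℕ-sym (suc a) (suc b) = adjℕ-sym a b

adjℕ-irrefl : ∀ a → adjℕ a a ≡ false
adjℕ-irrefl zero = refl
adjℕ-irrefl (suc a) = adjℕ-irrefl a

P : (n : ℕ) → Graph n
P n = record
  { adj = λ i j → adjℕ (toℕ i) (toℕ j)
  ; adj-sym = λ i j → adjℕ-sym (toℕ i) (toℕ j)
  ; adj-irrefl = λ i → adjℕ-irrefl (toℕ i)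
  }

-- edgeless graph on 0 and 1 vertices; P 1 is a single vertex
-- Disjoint union G + H on Fin (m + n): vertices of G first (via _↑ˡ_),
-- then vertices of H (via _↑ʳ_).
open import Data.Fin using (splitAt)
open import Data.Sum using (_⊎_; inj₁; inj₂)

module _ {m n : ℕ} (G : Graph m) (H : Graph n) where
  private
    a : Fin m ⊎ Fin n → Fin m ⊎ Fin n → Bool
    a (inj₁ i) (inj₁ j) = adj G i j
    a (inj₂ i) (inj₂ j) = adj H i j
    a _ _ = false
    a-sym : ∀ u v → a u v ≡ a v u
    a-sym (inj₁ i) (inj₁ j) = adj-sym G i j
    a-sym (inj₁ i) (inj₂ j) = refl
    a-sym (inj₂ i) (inj₁ j) = refl
    a-sym (inj₂ i) (inj₂ j) = adj-sym H i j
    a-irr : ∀ u → a u u ≡ false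
    a-irr (inj₁ i) = adj-irrefl G i
    a-irr (inj₂ i) = adj-irrefl H i

  _⊕_ : Graph (m Data.Nat.+ n)
  _⊕_ = record
    { adj = λ i j → a (splitAt m i) (splitAt m j)
    ; adj-sym = λ i j → a-sym (splitAt m i) (splitAt m j)
    ; adj-irrefl = λ i → a-irr (splitAt m i)
    }

co : ∀ {n} → Graph n → Graph n
co {n} G = record { adj = c ; adj-sym = c-sym ; adj-irrefl = c-irr }
  where
  c : Fin n → Fin n → Bool
  c i j with i ≟ j
  ... | yes _ = false
  ... | no _ = not (adj G i j)
  c-sym : ∀ i j → c i j ≡ c j i
  c-sym i j with i ≟ j | j ≟ i
  ... | yes _ | yes _ = refl
  ... | yes p | no q = Data.Empty.⊥-elim (q (sym p))
    where import Data.Empty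
  ... | no p | yes q = Data.Empty.⊥-elim (p (sym q))
    where import Data.Empty
  ... | no _ | no _ rewrite adj-sym G i j = refl
  c-irr : ∀ i → c i i ≡ false
  c-irr i with i ≟ i
  ... | yes _ = refl
  ... | no p = Data.Empty.⊥-elim (p refl)
    where import Data.Empty

2P1+P3 : Graph 5
2P1+P3 = (P 1 ⊕ P 1) ⊕ P 3

-- G^x : add a new vertex x' with N(x') = N(x) (x' non-adjacent to x).
-- The new vertex is zero; old vertex v becomes suc v.
cloneFalse : ∀ {n} (G : Graph n) (x : Fin n) → Graph (suc n)
cloneFalse {n} G x = record { adj = c ; adj-sym = c-sym ; adj-irrefl = c-irr }
  where
  c : Fin (suc n) → Fin (suc n) → Bool
  c zero zero = false
  c zero (suc j) = adj G x j
  c (suc i) zero = adj G i x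
  c (suc i) (suc j) = adj G i j
  c-sym : ∀ i j → c i j ≡ c j i
  c-sym zero zero = refl
  c-sym zero (suc j) = adj-sym G x j
  c-sym (suc i) zero = adj-sym G i x
  c-sym (suc i) (suc j) = adj-sym G i j
  c-irr : ∀ i → c i i ≡ false
  c-irr zero = refl
  c-irr (suc i) = adj-irrefl G i

module Submission where

-- One direction is immediate: G is an induced subgraph of G^x (shift every
-- vertex past the new one), so any forbidden pattern in G also lies in G^x.
--
-- For the other direction, collapse G^x onto G by sending x' to x.  This map
-- preserves adjacency and non-adjacency (x' and x are non-adjacent, and x' sees
-- what x sees), but it is injective only up to identifying x' with x, two
-- vertices with equal neighbourhoods.  Hence an induced copy of a *twin-free*
-- pattern H in G^x collapses to an induced copy of H in G: two pattern
-- vertices landing on the same vertex of G would be twins in H.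

open import Defs
open import Data.Nat using (ℕ)
open import Data.Fin using (Fin; zero; suc)
open import Data.Fin.Properties using (suc-injective; all?) renaming (_≟_ to _≟ᶠ_)
open import Data.Bool.Properties using () renaming (_≟_ to _≟ᵇ_)
open import Data.Product using (_×_; _,_)
open import Relation.Binary.PropositionalEquality using (_≡_; refl; sym; trans)
open import Relation.Nullary using (Dec)
open import Relation.Nullary.Decidable using (_→-dec_; toWitness)

NoTwins : ∀ {k} → Graph k → Set
NoTwins {k} H = ∀ (i j : Fin k) → (∀ l → adj H i l ≡ adj H j l) → i ≡ j

noTwins? : ∀ {k} (H : Graph k) → Dec (NoTwins H)
noTwins? H = all? λ i → all? λ j →
  all? (λ l → adj H i l ≟ᵇ adj H j l) →-dec (i ≟ᶠ j)

noTwins-P5 : NoTwins (P 5)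
noTwins-P5 = toWitness {a? = noTwins? (P 5)} _

noTwins-co2P1+P3 : NoTwins (co 2P1+P3)
noTwins-co2P1+P3 = toWitness {a? = noTwins? (co 2P1+P3)} _

module Clone {n : ℕ} (G : Graph n) (x : Fin n) where

  embed : ∀ {k} (H : Graph k) → InducedSub H G → InducedSub H (cloneFalse G x)
  embed H (f , f-inj , f-adj) =
    (λ i → suc (f i)) , (λ e → f-inj (suc-injective e)) , f-adj

  collapse : Fin (ℕ.suc n) → Fin n
  collapse zero    = x
  collapse (suc v) = v

  collapse-adj : ∀ u v → adj G (collapse u) (collapse v) ≡ adj (cloneFalse G x) u v
  collapse-adj zero    zero    = adj-irrefl G x
  collapse-adj zero    (suc v) = refl
  collapse-adj (suc u) zero    = refl
  collapse-adj (suc u) (suc v) = refl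

  collapse-twins : ∀ u v → collapse u ≡ collapse v →
                   ∀ w → adj (cloneFalse G x) u w ≡ adj (cloneFalse G x) v w
  collapse-twins zero    zero    _    w       = refl
  collapse-twins zero    (suc v) refl zero    = sym (adj-irrefl G x)
  collapse-twins zero    (suc v) refl (suc w) = refl
  collapse-twins (suc u) zero    refl zero    = adj-irrefl G x
  collapse-twins (suc u) zero    refl (suc w) = refl
  collapse-twins (suc u) (suc v) refl w       = refl

  -- A twin-free induced subgraph of G^x is also an induced subgraph of G:
  -- pattern vertices merged by the collapse would be twins in H.
  descend : ∀ {k} (H : Graph k) → NoTwins H →
            InducedSub H (cloneFalse G x) → InducedSub H G
  descend H noTwins (f , _ , f-adj) = (λ i → collapse (f i)) , injective , adjacency
    where
    adjacency : ∀ i j → adj G (collapse (f i)) (collapse (f j)) ≡ adj H i j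
    adjacency i j = trans (collapse-adj (f i) (f j)) (f-adj i j)

    injective : ∀ {i j} → collapse (f i) ≡ collapse (f j) → i ≡ j
    injective {i} {j} e = noTwins i j λ l →
      trans (sym (f-adj i l)) (trans (collapse-twins (f i) (f j) e (f l)) (f-adj j l))

free-transport : ∀ {k l m n} (H₁ : Graph k) (H₂ : Graph l) (G : Graph m) (G' : Graph n) →
                 (InducedSub H₁ G → InducedSub H₁ G') →
                 (InducedSub H₂ G → InducedSub H₂ G') →
                 Free₂ H₁ H₂ G' → Free₂ H₁ H₂ G
free-transport _ _ _ _ move₁ move₂ (free₁ , free₂) =
  (λ c → free₁ (move₁ c)) , (λ c → free₂ (move₂ c))

mainTheorem2 : ∀ {n} (G : Graph n) (x : Fin n) →
    (Free₂ (co 2P1+P3) (P 5) (cloneFalse G x) → Free₂ (co 2P1+P3) (P 5) G) ×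
    (Free₂ (co 2P1+P3) (P 5) G → Free₂ (co 2P1+P3) (P 5) (cloneFalse G x))
mainTheorem2 G x =
  free-transport (co 2P1+P3) (P 5) G (cloneFalse G x)
    (embed (co 2P1+P3)) (embed (P 5)) ,
  free-transport (co 2P1+P3) (P 5) (cloneFalse G x) G
    (descend (co 2P1+P3) noTwins-co2P1+P3) (descend (P 5) noTwins-P5)
  where open Clone G x
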